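{- Let $A$ be a finite set of atoms. For every permutation $\pi:A\to A$, associate the theory $\pi=\{\pi(a)\leftarrow a\mid a\in A\}$. The set of all such permutation theories forms a group under sequential composition $\circ$.
   Context: A theory over $A$ is a finite set of rules $a_0\leftarrow a_1,\ldots,a_k$ ($k\ge0$, $a_i\in A$), with $head(r)=\{a_0\}$, $body(r)=\{a_1,\ldots,a_k\}$, size $k$; $head(S),body(S)$ are unions over a set $S$ of rules. Write $S\subseteq_r R$ if $S\subseteq R$ has as many elements as the size of $r$. Composition: $P\circ R=\{head(r)\leftarrow body(S)\mid r\in P,\ S\subseteq_r R,\ head(S)=body(r)\}$. -}

module Defs where

open import Data.Nat using (ℕ)
open import Data.Fin using (Fin)
open import Data.Fin.Subset using (Subset; ⁅_⁆; _∪_; ∣_∣) renaming (⊥ to ∅)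
open import Data.Fin.Permutation using (Permutation′; _⟨$⟩ʳ_)
open import Data.List using (List; []; _∷_; foldr; length)
open import Data.List.Relation.Unary.All using (All)
open import Data.List.Relation.Unary.Unique.Propositional using (Unique)
open import Data.Product using (Σ; ∃; _×_; _,_)
open import Relation.Binary.PropositionalEquality using (_≡_)
open import Level using (suc; zero)

record Rule (n : ℕ) : Set where
  constructor _←_
  field
    hd   : Fin n
    bd   : Subset n
open Rule public

size : ∀ {n} → Rule n → ℕ
size r = ∣ bd r ∣

headR : ∀ {n} → Rule n → Subset n
headR r = ⁅ hd r ⁆

-- A theory is a set of rules (given by its membership predicate).  Over a finite set of
-- atoms there are only finitely many rules, so every such set is finite.
Theory : ℕ → Set₁
Theory n = Rule n → Set

headS : ∀ {n} → List (Rule n) → Subset n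
headS = foldr (λ r acc → headR r ∪ acc) ∅

bodyS : ∀ {n} → List (Rule n) → Subset n
bodyS = foldr (λ r acc → bd r ∪ acc) ∅

_⊆[_]_ : ∀ {n} → List (Rule n) → Rule n → Theory n → Set
S ⊆[ r ] R = Unique S × All R S × length S ≡ size r

_∘ₜ_ : ∀ {n} → Theory n → Theory n → Theory n
(P ∘ₜ R) r′ = Σ (Rule _) λ r → Σ (List (Rule _)) λ S →
  P r × S ⊆[ r ] R × headS S ≡ bd r × r′ ≡ (hd r ← bodyS S)

_≐_ : ∀ {n} → Theory n → Theory n → Set
P ≐ R = ∀ r → (P r → R r) × (R r → P r)

permTheory : ∀ {n} → Permutation′ n → Theory n
permTheory π r = Σ (Fin _) λ a → r ≡ ((π ⟨$⟩ʳ a) ← ⁅ a ⁆)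

IsPermTheory : ∀ {n} → Theory n → Set
IsPermTheory {n} T = Σ (Permutation′ n) λ π → T ≐ permTheory π

record FormGroup (n : ℕ) : Set₁ where
  field
    closure  : ∀ (P R : Theory n) → IsPermTheory P → IsPermTheory R → IsPermTheory (P ∘ₜ R)
    assoc    : ∀ (P Q R : Theory n) → IsPermTheory P → IsPermTheory Q → IsPermTheory R →
               ((P ∘ₜ Q) ∘ₜ R) ≐ (P ∘ₜ (Q ∘ₜ R))
    e        : Theory n
    e-perm   : IsPermTheory e
    identity : ∀ (P : Theory n) → IsPermTheory P → ((e ∘ₜ P) ≐ P) × ((P ∘ₜ e) ≐ P)
    inverse  : ∀ (P : Theory n) → IsPermTheory P → Σ (Theory n) λ Q → IsPermTheory Q ×
               ((P ∘ₜ Q) ≐ e) × ((Q ∘ₜ P) ≐ e)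

-- The theory of a permutation π consists of rules of size one, so in a composite
-- P ∘ R each rule of P picks exactly one rule of R and the heads must match: the
-- composite of the theories of π and σ is the theory of σ ∘ₚ π.  Hence π ↦ permTheory π
-- transports the group structure of the permutations of A to their theories.
module Submission where

open import Defs
open import Data.Nat using (ℕ)
open import Data.Fin using (Fin)
open import Data.Fin.Subset using (⁅_⁆; _∈_)
open import Data.Fin.Subset.Properties using (∣⁅x⁆∣≡1; x∈⁅x⁆; x∈⁅y⁆⇒x≡y; ∪-identityʳ)
open import Data.Fin.Permutation using (Permutation′; _⟨$⟩ʳ_; _∘ₚ_; id; flip; inverseˡ; inverseʳ)
open import Data.List using ([]; _∷_)
open import Data.List.Relation.Unary.All as All using ([]; _∷_)
open import Data.List.Relation.Unary.AllPairs using ([]; _∷_)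
open import Data.Product using (_,_; proj₁; proj₂)
open import Relation.Binary.PropositionalEquality using (_≡_; refl; sym; trans; cong; subst)

module PermutationTheories {n : ℕ} where

  ≐-refl : {P : Theory n} → P ≐ P
  ≐-refl r = (λ x → x) , (λ x → x)

  ≐-sym : {P R : Theory n} → P ≐ R → R ≐ P
  ≐-sym P≐R r = proj₂ (P≐R r) , proj₁ (P≐R r)

  ≐-trans : {P Q R : Theory n} → P ≐ Q → Q ≐ R → P ≐ R
  ≐-trans P≐Q Q≐R r = (λ x → proj₁ (Q≐R r) (proj₁ (P≐Q r) x))
                    , (λ x → proj₂ (P≐Q r) (proj₂ (Q≐R r) x))

  ∘ₜ-cong : {P P′ R R′ : Theory n} → P ≐ P′ → R ≐ R′ → (P ∘ₜ R) ≐ (P′ ∘ₜ R′)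
  ∘ₜ-cong P≐P′ R≐R′ r′ = transport P≐P′ R≐R′ , transport (≐-sym P≐P′) (≐-sym R≐R′)
    where
    transport : {P P′ R R′ : Theory n} → P ≐ P′ → R ≐ R′ → (P ∘ₜ R) r′ → (P′ ∘ₜ R′) r′
    transport P≐P′ R≐R′ (r , S , Pr , (unique , RS , len) , hS , eq) =
      r , S , proj₁ (P≐P′ r) Pr , (unique , All.map (λ {s} → proj₁ (R≐R′ s)) RS , len) , hS , eq

  ⁅⁆-injective : {a b : Fin n} → ⁅ a ⁆ ≡ ⁅ b ⁆ → a ≡ b
  ⁅⁆-injective {a} {b} eq = x∈⁅y⁆⇒x≡y b (subst (a ∈_) eq (x∈⁅x⁆ a))

  headS-[_] : (s : Rule n) → headS (s ∷ []) ≡ headR s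
  headS-[ s ] = ∪-identityʳ (headR s)

  bodyS-[_] : (s : Rule n) → bodyS (s ∷ []) ≡ bd s
  bodyS-[ s ] = ∪-identityʳ (bd s)

  permTheory-cong : (π σ : Permutation′ n) → (∀ a → π ⟨$⟩ʳ a ≡ σ ⟨$⟩ʳ a) →
                    permTheory π ≐ permTheory σ
  permTheory-cong π σ π≗σ r = (λ { (a , refl) → a , cong (_← ⁅ a ⁆) (π≗σ a) })
                            , (λ { (a , refl) → a , cong (_← ⁅ a ⁆) (sym (π≗σ a)) })

  permTheory-∘ : (π σ : Permutation′ n) →
                 (permTheory π ∘ₜ permTheory σ) ≐ permTheory (σ ∘ₚ π)
  permTheory-∘ π σ r′ = decompose , compose
    where
    decompose : (permTheory π ∘ₜ permTheory σ) r′ → permTheory (σ ∘ₚ π) r′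
    decompose (_ , [] , (a , refl) , (_ , _ , len) , _) with trans len (∣⁅x⁆∣≡1 a)
    ... | ()
    decompose (_ , _ ∷ _ ∷ _ , (a , refl) , (_ , _ , len) , _) with trans len (∣⁅x⁆∣≡1 a)
    ... | ()
    decompose (_ , s ∷ [] , (a , refl) , (_ , (c , refl) ∷ [] , _) , hS , refl)
      with ⁅⁆-injective (trans (sym headS-[ s ]) hS)
    ... | refl = c , cong ((π ⟨$⟩ʳ (σ ⟨$⟩ʳ c)) ←_) bodyS-[ s ]

    compose : permTheory (σ ∘ₚ π) r′ → (permTheory π ∘ₜ permTheory σ) r′
    compose (c , refl) =
      ((π ⟨$⟩ʳ b) ← ⁅ b ⁆) , s ∷ [] , (b , refl) ,
      (([] ∷ []) , ((c , refl) ∷ []) , sym (∣⁅x⁆∣≡1 b)) ,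
      headS-[ s ] , cong ((π ⟨$⟩ʳ b) ←_) (sym bodyS-[ s ])
      where
      b : Fin n
      b = σ ⟨$⟩ʳ c
      s : Rule n
      s = b ← ⁅ c ⁆

  ∘ₜ-permTheory : {P R : Theory n} (π σ : Permutation′ n) →
                  P ≐ permTheory π → R ≐ permTheory σ → (P ∘ₜ R) ≐ permTheory (σ ∘ₚ π)
  ∘ₜ-permTheory π σ hP hR = ≐-trans (∘ₜ-cong hP hR) (permTheory-∘ π σ)

proposition3p6 : (n : ℕ) → FormGroup n
proposition3p6 n = record
  { closure  = λ { _ _ (π , hP) (σ , hR) → σ ∘ₚ π , ∘ₜ-permTheory π σ hP hR }
  ; assoc    = λ { _ _ _ (π , hP) (σ , hQ) (ρ , hR) →
      ≐-trans (∘ₜ-permTheory (σ ∘ₚ π) ρ (∘ₜ-permTheory π σ hP hQ) hR)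
              (≐-sym (∘ₜ-permTheory π (ρ ∘ₚ σ) hP (∘ₜ-permTheory σ ρ hQ hR))) }
  ; e        = permTheory id
  ; e-perm   = id , ≐-refl
  ; identity = λ { _ (π , hP) →
        ≐-trans (∘ₜ-permTheory id π ≐-refl hP) (≐-sym hP)
      , ≐-trans (∘ₜ-permTheory π id hP ≐-refl) (≐-sym hP) }
  ; inverse  = λ { _ (π , hP) → permTheory (flip π) , (flip π , ≐-refl)
      , ≐-trans (∘ₜ-permTheory π (flip π) hP ≐-refl) (permTheory-cong (flip π ∘ₚ π) id (λ _ → inverseʳ π))
      , ≐-trans (∘ₜ-permTheory (flip π) π ≐-refl hP) (permTheory-cong (π ∘ₚ flip π) id (λ _ → inverseˡ π)) }
  }
  where open PermutationTheories {n}
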